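{- Let $S$ be a numerical semigroup with genus $g(S)$. Then $|S \cap [0,x]| \leq \frac{x}{2} + 1$ for every $x \in \mathbb{N}$ with $x \leq 2g(S) - 2$.
   Context: A numerical semigroup is a subset $S \subseteq \mathbb{N} = \{0,1,2,\ldots\}$ closed under addition, containing $0$, with finite complement. Its genus is $g(S) := |\mathbb{N}\setminus S|$. -}

module Defs where

open import Data.Nat using (ℕ; zero; suc; _+_; _≤_)
open import Data.Bool using (Bool; true; false)
open import Relation.Binary.PropositionalEquality using (_≡_)

record NumericalSemigroup : Set where
  field
    mem      : ℕ → Bool
    has-zero : mem 0 ≡ true
    closed   : ∀ a b → mem a ≡ true → mem b ≡ true → mem (a + b) ≡ true
    bound    : ℕ
    cofinite : ∀ n → bound ≤ n → mem n ≡ true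

open NumericalSemigroup public

countBelow : (ℕ → Bool) → Bool → ℕ → ℕ
countBelow p b zero = zero
countBelow p b (suc k) with p k | b
... | true  | true  = suc (countBelow p b k)
... | false | false = suc (countBelow p b k)
... | _     | _     = countBelow p b k

-- genus g(S) = |ℕ \ S|; all gaps lie below `bound`
genus : NumericalSemigroup → ℕ
genus S = countBelow (mem S) false (bound S)

countUpTo : NumericalSemigroup → ℕ → ℕ
countUpTo S x = countBelow (mem S) true (suc x)

-- If h is a gap of S, then h − i is a gap for every element i ≤ h, so S ∩ [0, h] injects into the
-- gaps in [0, h] and 2 |S ∩ [0, h]| ≤ h + 1. For x ≤ 2g − 2 there must be a gap ≥ x: otherwise all
-- g gaps lie in [0, x], leaving at most x + 1 − g ≤ x / 2 elements there. Between x and the first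
-- gap h ≥ x there are only elements, each adding 2 to the left side and 1 to the right side, so the
-- bound at h transfers back to x with a slack of at most 1.
module Submission where

open import Defs
open import Data.Nat using (ℕ; zero; suc; _+_; _*_; _∸_; _≤_; _<_; z≤n; s≤s; s≤s⁻¹; _<?_)
open import Data.Nat.Properties
open import Data.Nat.Tactic.RingSolver using (solve-∀)
open import Algebra.Properties.CommutativeSemigroup +-commutativeSemigroup using (x∙yz≈y∙xz)
open import Data.Bool using (Bool; true; false)
open import Data.Bool.Properties using (¬-not) renaming (_≟_ to _≟ᵇ_)
open import Data.Fin using (Fin; toℕ; fromℕ<)
open import Data.Fin.Properties using (all?; ¬∀⟶∃¬; toℕ-fromℕ<)
open import Data.Product using (∃; _,_)
open import Data.Sum using (_⊎_; inj₁; inj₂)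
open import Relation.Nullary using (yes; no; contradiction)
open import Relation.Binary.PropositionalEquality

δ : Bool → Bool → ℕ
δ true  true  = 1
δ false false = 1
δ true  false = 0
δ false true  = 0

δ-refl : ∀ b → δ b b ≡ 1
δ-refl true  = refl
δ-refl false = refl

δ-mono : ∀ {a b a′ b′} → (a ≡ b → a′ ≡ b′) → δ a b ≤ δ a′ b′
δ-mono {true}  {false} _ = z≤n
δ-mono {false} {true}  _ = z≤n
δ-mono {true}  {true}  {b′ = b′} h rewrite h refl = ≤-reflexive (sym (δ-refl b′))
δ-mono {false} {false} {b′ = b′} h rewrite h refl = ≤-reflexive (sym (δ-refl b′))

countBelow-suc : ∀ p b k → countBelow p b (suc k) ≡ δ (p k) b + countBelow p b k
countBelow-suc p b k with p k | b
... | true  | true  = refl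
... | false | false = refl
... | true  | false = refl
... | false | true  = refl

countBelow-true+false : ∀ p k → countBelow p true k + countBelow p false k ≡ k
countBelow-true+false p zero = refl
countBelow-true+false p (suc k)
  rewrite countBelow-suc p true k | countBelow-suc p false k with p k
... | true  = cong suc (countBelow-true+false p k)
... | false = trans (+-suc _ _) (cong suc (countBelow-true+false p k))

countBelow-cong : ∀ {f g} b k → (∀ i → i < k → f i ≡ g i) → countBelow f b k ≡ countBelow g b k
countBelow-cong b zero f≗g = refl
countBelow-cong {f} {g} b (suc k) f≗g
  rewrite countBelow-suc f b k | countBelow-suc g b k | f≗g k ≤-refl =
  cong (δ (g k) b +_) (countBelow-cong b k (λ i i<k → f≗g i (m≤n⇒m≤1+n i<k)))

countBelow-≤-suc : ∀ p b k → countBelow p b k ≤ countBelow p b (suc k)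
countBelow-≤-suc p b k rewrite countBelow-suc p b k = m≤n+m _ (δ (p k) b)

countBelow-monoʳ-≤ : ∀ p b {m n} → m ≤ n → countBelow p b m ≤ countBelow p b n
countBelow-monoʳ-≤ p b {n = zero} z≤n = ≤-refl
countBelow-monoʳ-≤ p b {n = suc n} m≤1+n with m≤n⇒m<n∨m≡n m≤1+n
... | inj₂ refl   = ≤-refl
... | inj₁ m<1+n  = ≤-trans (countBelow-monoʳ-≤ p b (s≤s⁻¹ m<1+n)) (countBelow-≤-suc p b n)

countBelow-shift : ∀ f b n →
  countBelow f b (suc n) ≡ δ (f 0) b + countBelow (λ i → f (suc i)) b n
countBelow-shift f b zero rewrite countBelow-suc f b 0 = refl
countBelow-shift f b (suc n)
  rewrite countBelow-suc f b (suc n) | countBelow-shift f b n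
        | countBelow-suc (λ i → f (suc i)) b n =
  x∙yz≈y∙xz (δ (f (suc n)) b) (δ (f 0) b) _

countBelow-reflect : ∀ n f b → countBelow (λ i → f (n ∸ i)) b (suc n) ≡ countBelow f b (suc n)
countBelow-reflect zero f b = trans (countBelow-suc (λ i → f (0 ∸ i)) b 0) (sym (countBelow-suc f b 0))
countBelow-reflect (suc n) f b = begin
  countBelow (λ i → f (suc n ∸ i)) b (suc (suc n))
    ≡⟨ countBelow-suc (λ i → f (suc n ∸ i)) b (suc n) ⟩
  δ (f (suc n ∸ suc n)) b + countBelow (λ i → f (suc n ∸ i)) b (suc n)
    ≡⟨ cong₂ _+_ (cong (λ z → δ (f z) b) (n∸n≡0 n))
                 (countBelow-cong b (suc n) (λ i i<1+n → cong f (+-∸-assoc 1 (s≤s⁻¹ i<1+n)))) ⟩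
  δ (f 0) b + countBelow (λ i → f (suc (n ∸ i))) b (suc n)
    ≡⟨ cong (δ (f 0) b +_) (countBelow-reflect n (λ j → f (suc j)) b) ⟩
  δ (f 0) b + countBelow (λ i → f (suc i)) b (suc n)
    ≡⟨ countBelow-shift f b (suc n) ⟨
  countBelow f b (suc (suc n)) ∎
  where open ≡-Reasoning

countBelow-mono : ∀ {p q} b c k → (∀ i → i < k → p i ≡ b → q i ≡ c) →
  countBelow p b k ≤ countBelow q c k
countBelow-mono b c zero _ = z≤n
countBelow-mono {p} {q} b c (suc k) h
  rewrite countBelow-suc p b k | countBelow-suc q c k =
  +-mono-≤ (δ-mono (h k ≤-refl)) (countBelow-mono b c k (λ i i<k → h i (m≤n⇒m≤1+n i<k)))

countBelow-false-≤ : ∀ p m n → (∀ i → m ≤ i → p i ≡ true) →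
  countBelow p false n ≤ countBelow p false m
countBelow-false-≤ p m zero _ = z≤n
countBelow-false-≤ p m (suc n) p≥m with m ≤? n
... | yes m≤n rewrite countBelow-suc p false n | p≥m n m≤n = countBelow-false-≤ p m n p≥m
... | no  m≰n = countBelow-monoʳ-≤ p false (≰⇒> m≰n)

gapCountUpTo : NumericalSemigroup → ℕ → ℕ
gapCountUpTo S x = countBelow (mem S) false (suc x)

countUpTo+gapCountUpTo : ∀ S x → countUpTo S x + gapCountUpTo S x ≡ x + 1
countUpTo+gapCountUpTo S x = trans (countBelow-true+false (mem S) (suc x)) (+-comm 1 x)

module _ (S : NumericalSemigroup) where

  gap-∸-element : ∀ {h i} → mem S h ≡ false → i ≤ h → mem S i ≡ true → mem S (h ∸ i) ≡ false
  gap-∸-element {h} {i} h∉S i≤h i∈S = ¬-not λ h∸i∈S →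
    contradiction (trans (sym (h∈S h∸i∈S)) h∉S) λ ()
    where
    h∈S : mem S (h ∸ i) ≡ true → mem S h ≡ true
    h∈S h∸i∈S = subst (λ n → mem S n ≡ true) (m+[n∸m]≡n i≤h) (closed S i (h ∸ i) i∈S h∸i∈S)

  countUpTo-≤-gapCountUpTo : ∀ {h} → mem S h ≡ false → countUpTo S h ≤ gapCountUpTo S h
  countUpTo-≤-gapCountUpTo {h} h∉S =
    subst (countUpTo S h ≤_) (countBelow-reflect h (mem S) false)
      (countBelow-mono true false (suc h) (λ i i<1+h → gap-∸-element h∉S (s≤s⁻¹ i<1+h)))

  countUpTo-gap : ∀ {h} → mem S h ≡ false → 2 * countUpTo S h ≤ h + 1
  countUpTo-gap {h} h∉S = begin
    2 * c                 ≡⟨ cong (c +_) (+-identityʳ c) ⟩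
    c + c                 ≤⟨ +-monoʳ-≤ c (countUpTo-≤-gapCountUpTo h∉S) ⟩
    c + gapCountUpTo S h  ≡⟨ countUpTo+gapCountUpTo S h ⟩
    h + 1                 ∎
    where
    open ≤-Reasoning
    c : ℕ
    c = countUpTo S h

  countUpTo-below-gap : ∀ d x → mem S (x + d) ≡ false → 2 * countUpTo S x ≤ x + 2
  countUpTo-below-gap zero x x∉S rewrite +-identityʳ x = ≤-trans (countUpTo-gap x∉S) (+-monoʳ-≤ x (s≤s z≤n))
  -- Abstracting over mem S (suc x) also unfolds countUpTo S (suc x) in the two bounds.
  countUpTo-below-gap (suc d) x x+1+d∉S
    with mem S (suc x)
       | countUpTo-below-gap d (suc x) (subst (λ n → mem S n ≡ false) (+-suc x d) x+1+d∉S)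
       | countUpTo-gap {suc x}
  ... | true  | ih | _   = ≤-trans (n≤1+n _) (s≤s⁻¹ (subst (_≤ suc x + 2) (*-suc 2 (countUpTo S x)) ih))
  ... | false | _  | gap = subst (2 * countUpTo S x ≤_) (sym (+-suc x 1)) (gap refl)

  gap-from⊎elements-from : ∀ x → (∃ λ d → mem S (x + d) ≡ false) ⊎ (∀ i → x ≤ i → mem S i ≡ true)
  gap-from⊎elements-from x with all? (λ (j : Fin (bound S)) → mem S (x + toℕ j) ≟ᵇ true)
  ... | no ¬all = let j , x+j∉S = ¬∀⟶∃¬ _ _ (λ j → mem S (x + toℕ j) ≟ᵇ true) ¬all
                  in inj₁ (toℕ j , ¬-not x+j∉S)
  ... | yes all = inj₂ λ i x≤i → subst (λ n → mem S n ≡ true) (m+[n∸m]≡n x≤i) (element (i ∸ x))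
    where
    element : ∀ k → mem S (x + k) ≡ true
    element k with k <? bound S
    ... | yes k<b = subst (λ n → mem S (x + n) ≡ true) (toℕ-fromℕ< k<b) (all (fromℕ< k<b))
    ... | no  k≮b = cofinite S (x + k) (≤-trans (≮⇒≥ k≮b) (m≤n+m k x))

  genus-≤-gapCountUpTo : ∀ x → (∀ i → x ≤ i → mem S i ≡ true) → genus S ≤ gapCountUpTo S x
  genus-≤-gapCountUpTo x elements =
    countBelow-false-≤ (mem S) (suc x) (bound S) (λ i x<i → elements i (<⇒≤ x<i))

double-≤-from-complement : ∀ {m n k} → m + n ≡ k + 1 → k + 2 ≤ 2 * n → 2 * m ≤ k
double-≤-from-complement {m} {n} {k} m+n≡k+1 k+2≤2n = +-cancelʳ-≤ (k + 2) (2 * m) k (begin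
  2 * m + (k + 2)  ≤⟨ +-monoʳ-≤ (2 * m) k+2≤2n ⟩
  2 * m + 2 * n    ≡⟨ *-distribˡ-+ 2 m n ⟨
  2 * (m + n)      ≡⟨ cong (2 *_) m+n≡k+1 ⟩
  2 * (k + 1)      ≡⟨ double-+1 k ⟩
  k + (k + 2)      ∎)
  where
  open ≤-Reasoning
  double-+1 : ∀ k → 2 * (k + 1) ≡ k + (k + 2)
  double-+1 = solve-∀

theorem2p8 : (S : NumericalSemigroup) (x : ℕ) → x + 2 ≤ 2 * genus S →
    2 * countUpTo S x ≤ x + 2
theorem2p8 S x x+2≤2g with gap-from⊎elements-from S x
... | inj₁ (d , x+d∉S) = countUpTo-below-gap S d x x+d∉S
... | inj₂ elements    = ≤-trans (double-≤-from-complement {countUpTo S x} (countUpTo+gapCountUpTo S x) x+2≤2G)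
                                   (m≤m+n x 2)
  where
  x+2≤2G : x + 2 ≤ 2 * gapCountUpTo S x
  x+2≤2G = ≤-trans x+2≤2g (*-monoʳ-≤ 2 (genus-≤-gapCountUpTo S x elements))
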